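{- Let $u$ be a set, let $F$ and $G$ be conjunctive set transformers of type $\mathbb{P}(u)\to\mathbb{P}(u)$ with $F(u)=u$ and $G(u)=u$, let $q\subseteq u$, and let $X(q)$ be the fair iteration defined recursively by $X(q) = \overline{q}\Longrightarrow ((F\,;\,X(q))\mathrel{\triangledown} G)$. Then for all $s,t\subseteq u$ with $s\subseteq t$ we have $X(q)(s)\subseteq X(q)(t)$.
   Context: A set transformer on a set $u$ is a map $\mathbb{P}(u)\to\mathbb{P}(u)$; it is conjunctive if it distributes over (nonempty) intersections, hence is monotone. For $a\subseteq u$ write $\overline{a}=u\setminus a$. For a set transformer $S$: $\mathsf{pre}(S)=S(u)$ and $\mathsf{grd}(S)=\overline{S(\varnothing)}$. Each set transformer $S$ has a liberal set transformer $\mathcal{L}(S)$, related by the pairing condition $S(r)=\mathcal{L}(S)(r)\cap\mathsf{pre}(S)$; if $S(u)=u$ then $S=\mathcal{L}(S)$. Operators: $(S\,[\!]\,T)(r)=S(r)\cap T(r)$, $\mathcal{L}(S\,[\!]\,T)(r)=\mathcal{L}(S)(r)\cap\mathcal{L}(T)(r)$; $(S;T)(r)=S(T(r))$, $\mathcal{L}(S;T)(r)=\mathcal{L}(S)(\mathcal{L}(T)(r))$; for $a\subseteq u$: $(a\Longrightarrow S)(r)=\overline{a}\cup S(r)$, $\mathcal{L}(a\Longrightarrow S)(r)=\overline a\cup\mathcal{L}(S)(r)$; $(a\,|\,S)(r)=a\cap S(r)$. Dovetail operator: $\mathcal{L}(S\mathrel{\triangledown}T)(r)=\mathcal{L}(S)(r)\cap\mathcal{L}(T)(r)$,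 $\mathsf{pre}(S\mathrel{\triangledown}T)=(S(u)\cap T(u))\cup(\overline{S(\varnothing)}\cap S(u))\cup(\overline{T(\varnothing)}\cap T(u))$, and $(S\mathrel{\triangledown}T)(r)=\mathcal{L}(S\mathrel{\triangledown}T)(r)\cap\mathsf{pre}(S\mathrel{\triangledown}T)$. For recursively defined transformers, the set transformer is the least fixpoint and the liberal set transformer the greatest fixpoint of the monotone function obtained by unfolding the recursive equation with these rules. -}

module Defs where

open import Level using (0ℓ)
open import Function using (_∘_)
open import Relation.Unary using (Pred; _⊆_; _≐_; _∩_; _∪_; ∁; U; ∅; ⋂)

-- Subsets of a carrier type A (the set u is the universal predicate U).
Sub : Set → Set₁
Sub A = Pred A 0ℓ

Transformer : Set → Set₁
Transformer A = Sub A → Sub A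

-- Set transformers respect extensional equality of subsets
-- (automatic in set theory, must be required for predicates).
Congruent : {A : Set} → Transformer A → Set₁
Congruent S = ∀ {a b} → a ≐ b → S a ≐ S b

-- Conjunctive: distributes over nonempty intersections.
Conjunctive : {A : Set} → Transformer A → Set₁
Conjunctive {A} S =
  (I : Set) → I → (f : I → Sub A) → S (⋂ I f) ≐ ⋂ I (S ∘ f)

_⊑_ : {A : Set} → Transformer A → Transformer A → Set₁
S ⊑ T = ∀ r → S r ⊆ T r

_≋_ : {A : Set} → Transformer A → Transformer A → Set₁
S ≋ T = ∀ r → S r ≐ T r

record IsLfp {A : Set} (Φ : Transformer A → Transformer A) (X : Transformer A) : Set₂ where
  field
    congruent : Congruent X
    fixpoint  : Φ X ≋ X
    least     : ∀ Y → Congruent Y → Φ Y ⊑ Y → X ⊑ Y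

record IsGfp {A : Set} (Φ : Transformer A → Transformer A) (X : Transformer A) : Set₂ where
  field
    congruent : Congruent X
    fixpoint  : Φ X ≋ X
    greatest  : ∀ Y → Congruent Y → Y ⊑ Φ Y → Y ⊑ X

-- A statement: set transformer together with its liberal set transformer.
record Stmt (A : Set) : Set₁ where
  constructor ⟨_,_⟩
  field
    wp  : Transformer A
    wlp : Transformer A
open Stmt public

pre : {A : Set} → Stmt A → Sub A
pre S = wp S U

grd : {A : Set} → Stmt A → Sub A
grd S = ∁ (wp S ∅)

-- A transformer S with S(u) = u is its own liberal transformer.
total : {A : Set} → Transformer A → Stmt A
total F = ⟨ F , F ⟩

_⨾_ : {A : Set} → Stmt A → Stmt A → Stmt A
S ⨾ T = ⟨ (λ r → wp S (wp T r)) , (λ r → wlp S (wlp T r)) ⟩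

_⟹_ : {A : Set} → Sub A → Stmt A → Stmt A
a ⟹ S = ⟨ (λ r → ∁ a ∪ wp S r) , (λ r → ∁ a ∪ wlp S r) ⟩

_▽_ : {A : Set} → Stmt A → Stmt A → Stmt A
S ▽ T = ⟨ (λ r → L r ∩ p) , L ⟩
  where
    L : _
    L r = wlp S r ∩ wlp T r
    p : _
    p = (pre S ∩ pre T) ∪ (grd S ∩ pre S) ∪ (grd T ∩ pre T)

fairBody : {A : Set} → Transformer A → Transformer A → Sub A → Stmt A → Stmt A
fairBody F G q X = ∁ q ⟹ ((total F ⨾ X) ▽ total G)

-- (Xs, Xl) is the fair iteration X(q): its liberal transformer Xl is the
-- greatest fixpoint of the liberal unfolding, and its set transformer Xs is
-- the least fixpoint of the (set-transformer) unfolding.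
record IsFairIteration {A : Set} (F G : Transformer A) (q : Sub A)
                       (Xs Xl : Transformer A) : Set₂ where
  field
    liberal-gfp : IsGfp (λ Y → wlp (fairBody F G q ⟨ Xs , Y ⟩)) Xl
    set-lfp     : IsLfp (λ Y → wp (fairBody F G q ⟨ Y , Xl ⟩)) Xs

{-# OPTIONS --safe #-}
-- The liberal transformer Xl is the greatest fixpoint of
-- Y ↦ (r ↦ q ∪ (F (Y r) ∩ G r)), an unfolding that is monotone both in r and in
-- the value Y r. Hence, for s ⊆ t, the transformer r ↦ Xl r ∪ (Xl s if s ⊆ r) is a
-- post-fixpoint, and coinduction gives Xl s ⊆ Xl t. The set transformer Xs is a
-- fixpoint of r ↦ q ∪ ((F (Xl r) ∩ G r) ∩ p), where the precondition p does not
-- depend on r, so monotonicity of Xl, F and G passes to Xs.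
module Submission where

open import Data.Bool using (Bool; true; false)
open import Data.Product using (_×_; _,_; proj₁; proj₂)
open import Data.Sum using (_⊎_; inj₁; inj₂)
import Data.Product as Product
import Data.Sum as Sum
open import Function using (_∘_)
open import Relation.Binary.Core using (_Preserves_⟶_; _Preserves₂_⟶_⟶_)
open import Relation.Unary using (_⊆_; _≐_; _∩_; _∪_; ∁; U; ⋂)
open import Relation.Unary.Properties using (≐-sym)

open import Defs

private
  variable
    A : Set

Monotone : Transformer A → Set₁
Monotone S = S Preserves _⊆_ ⟶ _⊆_

conjunctive⇒monotone : (S : Transformer A) → Congruent S → Conjunctive S → Monotone S
conjunctive⇒monotone {A} S congruent conjunctive {s} {t} s⊆t =
  (λ Ss∩t → proj₁ (conjunctive Bool true s∩t) Ss∩t false) ∘ proj₁ (congruent s≐s∩t)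
  where
    s∩t : Bool → Sub A
    s∩t true  = s
    s∩t false = t

    s≐s∩t : s ≐ ⋂ Bool s∩t
    s≐s∩t = (λ x∈s → λ { true → x∈s ; false → s⊆t x∈s }) , (λ x∈s∩t → x∈s∩t true)

module _ (Ψ : Sub A → Sub A → Sub A) (Ψ-mono : Ψ Preserves₂ _⊆_ ⟶ _⊆_ ⟶ _⊆_)
         {X : Transformer A} (X-gfp : IsGfp (λ Y r → Ψ r (Y r)) X) where

  open IsGfp X-gfp

  private
    above : Sub A → Transformer A
    above s r x = X r x ⊎ (s ⊆ r × X s x)

    above-respects : ∀ {s r r′} → r ≐ r′ → above s r ⊆ above s r′
    above-respects r≐r′ (inj₁ x∈Xr)        = inj₁ (proj₁ (congruent r≐r′) x∈Xr)
    above-respects r≐r′ (inj₂ (s⊆r , x∈Xs)) = inj₂ ((λ x∈s → proj₁ r≐r′ (s⊆r x∈s)) , x∈Xs)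

    above-congruent : ∀ s → Congruent (above s)
    above-congruent s r≐r′ = above-respects r≐r′ , above-respects (≐-sym r≐r′)

    X⊆above : ∀ {s r} → s ⊆ r → X s ⊆ above s r
    X⊆above s⊆r x∈Xs = inj₂ (s⊆r , x∈Xs)

    above-postfixpoint : ∀ s r → above s r ⊆ Ψ r (above s r)
    above-postfixpoint s r (inj₁ x∈Xr)        = Ψ-mono (λ x∈r → x∈r) inj₁ (proj₂ (fixpoint r) x∈Xr)
    above-postfixpoint s r (inj₂ (s⊆r , x∈Xs)) = Ψ-mono s⊆r (X⊆above s⊆r) (proj₂ (fixpoint s) x∈Xs)

  gfp-monotone : Monotone X
  gfp-monotone {s} {t} s⊆t x∈Xs =
    greatest (above s) (above-congruent s) (above-postfixpoint s) t (inj₂ (s⊆t , x∈Xs))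

lemma3 : {A : Set} (F G : Transformer A)
         → Congruent F → Conjunctive F → F U ≐ U
         → Congruent G → Conjunctive G → G U ≐ U
         → (q : Sub A) (Xs Xl : Transformer A)
         → IsFairIteration F G q Xs Xl
         → (s t : Sub A) → s ⊆ t → Xs s ⊆ Xs t
lemma3 F G F-congruent F-conjunctive _ G-congruent G-conjunctive _ q Xs Xl fair s t s⊆t =
  proj₁ (fixpoint t) ∘ Sum.map₂ (Product.map₁ (Product.map (F-mono (Xl-mono s⊆t)) (G-mono s⊆t)))
    ∘ proj₂ (fixpoint s)
  where
    open IsLfp (IsFairIteration.set-lfp fair)

    F-mono : Monotone F
    F-mono = conjunctive⇒monotone F F-congruent F-conjunctive

    G-mono : Monotone G
    G-mono = conjunctive⇒monotone G G-congruent G-conjunctive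

    Xl-mono : Monotone Xl
    Xl-mono = gfp-monotone (λ r a → ∁ (∁ q) ∪ (F a ∩ G r))
      (λ r⊆r′ a⊆a′ → Sum.map₂ (Product.map (F-mono a⊆a′) (G-mono r⊆r′)))
      (IsFairIteration.liberal-gfp fair)
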